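{- Let $G$ be a linear genome over $\{0,\ldots,n+1\}$ and let $S$ be an arbitrary sequence of prefix DCJs transforming $G$ into a genome $G'$. Then (1) $G'$ contains exactly one path, and its endpoints are $0$ and $n+1$; (2) every other component of $G'$ (if any) is a cycle.
   Context: A (unsigned) genome is a collection of vertex-disjoint paths and cycles (multigraph; loops and parallel edges allowed) over $\{0,1,\ldots,n+1\}$; it is linear if it consists of a single path with endpoints $0$ and $n+1$. A DCJ on a genome takes two distinct edges $e=\{u,v\}$, $f=\{w,x\}$ and replaces them by either $\{u,w\},\{v,x\}$ or $\{u,x\},\{v,w\}$; it is a prefix DCJ if $0\in e$ or $0\in f$. -}

module Defs where

open import Data.Nat using (ℕ; zero; suc)
open import Data.Fin using (Fin; _≟_)
open import Data.Bool using (Bool; _∧_; _∨_)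
open import Data.Product using (Σ; _×_; _,_)
open import Data.Sum using (_⊎_)
open import Data.List using (List; []; _∷_; _++_; [_]; filter; length; last)
open import Data.List.Membership.Propositional using (_∈_)
open import Data.List.Relation.Unary.Unique.Propositional using (Unique)
open import Relation.Nullary.Decidable using (does)
open import Relation.Binary.PropositionalEquality using (_≡_)
open import Relation.Binary.Construct.Closure.ReflexiveTransitive using (Star)
open import Function.Bundles using (_⇔_)
open import Data.Nat using (_≥_)

V : ℕ → Set
V n = Fin (suc (suc n))

-- An (unordered) edge {u,v}, stored as a pair; orientation is irrelevant
-- since everything below only inspects edges through `count`.
Edge : ℕ → Set
Edge n = V n × V n

-- A (multi)graph on {0,…,n+1}: a list of edges (a multiset; loops and
-- parallel edges allowed).
Graph : ℕ → Set
Graph n = List (Edge n)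

isEdge : ∀ {n} → V n → V n → Edge n → Bool
isEdge a b (u , w) = (does (u ≟ a) ∧ does (w ≟ b)) ∨ (does (u ≟ b) ∧ does (w ≟ a))

count : ∀ {n} → V n → V n → Graph n → ℕ
count a b E = length (filter (λ e → isEdge a b e Data.Bool.≟ Bool.true) E)
  where import Data.Bool

_≈ₘ_ : ∀ {n} → Graph n → Graph n → Set
E ≈ₘ F = ∀ a b → count a b E ≡ count a b F

Adj : ∀ {n} → Graph n → V n → V n → Set
Adj E a b = count a b E ≥ 1

Reach : ∀ {n} → Graph n → V n → V n → Set
Reach E = Star (Adj E)

pathEdges : ∀ {n} → List (V n) → Graph n
pathEdges [] = []
pathEdges (x ∷ []) = []
pathEdges (x ∷ y ∷ r) = (x , y) ∷ pathEdges (y ∷ r)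

-- The connected component of `a` in E is a path with endpoints a and b:
-- its vertices, listed without repetition from a to b, are exactly the
-- vertices reachable from a, and the edges of E at these vertices are
-- exactly the consecutive pairs (as a multiset).
PathComp : ∀ {n} → Graph n → V n → V n → Set
PathComp {n} E a b = Σ (List (V n)) λ rest →
    Unique (a ∷ rest)
  × last (a ∷ rest) ≡ Data.Maybe.just b
  × (∀ w → (w ∈ a ∷ rest) ⇔ Reach E a w)
  × (∀ x y → x ∈ a ∷ rest → count x y E ≡ count x y (pathEdges (a ∷ rest)))
  where import Data.Maybe

-- The connected component of v in E is a cycle v = v0 - v1 - … - vk - v0
-- (k = 0: a loop; k = 1: two parallel edges).
cycleEdges : ∀ {n} → V n → List (V n) → Graph n
cycleEdges v rest = pathEdges (v ∷ rest) ++ [ (lastOr v rest , v) ]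
  where
  lastOr : ∀ {A : Set} → A → List A → A
  lastOr x [] = x
  lastOr x (y ∷ ys) = lastOr y ys

CycleComp : ∀ {n} → Graph n → V n → Set
CycleComp {n} E v = Σ (List (V n)) λ rest →
    Unique (v ∷ rest)
  × (∀ w → (w ∈ v ∷ rest) ⇔ Reach E v w)
  × (∀ x y → x ∈ v ∷ rest → count x y E ≡ count x y (cycleEdges v rest))

v0 : ∀ {n} → V n
v0 = Fin.zero
  where import Data.Fin as Fin

vEnd : ∀ n → V n
vEnd n = Data.Fin.fromℕ (suc n)

Linear : ∀ n → Graph n → Set
Linear n E = PathComp E v0 (vEnd n) × (∀ w → Reach E v0 w)

-- A DCJ: take two distinct edges {u,v},{w,x} (distinct list entries, so
-- parallel copies count as distinct edges) and replace them by
-- {u,w},{v,x} or {u,x},{v,w}.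
PrefixDCJ : ∀ {n} → Graph n → Graph n → Set
PrefixDCJ {n} E E' = Σ (V n) λ u → Σ (V n) λ v → Σ (V n) λ w → Σ (V n) λ x →
  Σ (Graph n) λ R →
    (u ≡ v0 ⊎ v ≡ v0 ⊎ w ≡ v0 ⊎ x ≡ v0)
  × E ≈ₘ ((u , v) ∷ (w , x) ∷ R)
  × (E' ≈ₘ ((u , w) ∷ (v , x) ∷ R) ⊎ E' ≈ₘ ((u , x) ∷ (v , w) ∷ R))

PrefixDCJs : ∀ {n} → Graph n → Graph n → Set
PrefixDCJs = Star PrefixDCJ

module Submission where

-- A DCJ replaces two edges by two edges on the same four endpoints, so it preserves every
-- vertex degree. A linear genome has degree 1 at 0 and
-- n+1 and degree 2 elsewhere, hence so does G'. Walk in G' from 0, always leaving the current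
-- end of the trail along an unused edge: the degrees force the current end to have exactly
-- one unused edge and the earlier trail vertices none, so the walk never revisits a vertex
-- and can only stop at n+1, having traced the whole component of 0 as a path. A vertex w
-- outside that component only reaches vertices of degree 2, so the same walk from w can only
-- stop by returning to w, and traces a cycle.

open import Defs
open import Algebra.Properties.CommutativeMonoid.Sum as Sum using ()
open import Data.Bool using (Bool; true; false; _∧_; _∨_)
open import Data.Bool.Properties using (∧-comm; ∨-comm; ∧-zeroʳ; ∧-identityʳ; ∨-identityʳ; ∨-idem)
open import Data.Empty using (⊥; ⊥-elim)
open import Data.Fin using (Fin; zero; suc; _≟_)
open import Data.List using (List; []; _∷_; _++_; [_]; last; length)
open import Data.List.Membership.Propositional using (_∈_; _∉_)
open import Data.List.Relation.Unary.All as All using ([])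
open import Data.List.Relation.Unary.All.Properties using (All¬⇒¬Any)
open import Data.List.Relation.Unary.AllPairs using ([]; _∷_)
open import Data.List.Relation.Unary.Any using (here; there; any?)
open import Data.List.Relation.Unary.Unique.Propositional using (Unique)
import Data.List.Relation.Unary.Unique.Propositional.Properties as Unique
open import Data.Maybe using (just)
open import Data.Maybe.Properties using (just-injective)
open import Data.Nat using (ℕ; zero; suc; _+_; _≤_; _<_; z≤n; s≤s)
open import Data.Nat.Induction using (<-wellFounded)
open import Data.Nat.Properties hiding (_≟_)
open import Data.Product using (Σ; _,_; proj₁; proj₂; _×_)
open import Data.Sum using (inj₁; inj₂)
open import Data.Vec.Functional using (removeAt)
open import Function using (_∘_)
open import Function.Bundles using (Equivalence; _⇔_; mk⇔)
open import Induction.WellFounded using (Acc; acc)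
open import Relation.Binary.Construct.Closure.ReflexiveTransitive using (ε; _◅_; _◅◅_; reverse)
open import Relation.Binary.PropositionalEquality hiding ([_])
open import Relation.Nullary using (Dec; does; yes; no; ¬_; contradiction)
open import Relation.Nullary.Decidable using (dec-true; dec-false)

open Sum +-0-commutativeMonoid using (sum; sum-cong-≗; ∑-distrib-+; sum-remove; sum-replicate-zero)
open import Algebra.Properties.CommutativeSemigroup +-commutativeSemigroup
  using (interchange; xy∙z≈y∙xz; x∙yz≈y∙xz)

bit : Bool → ℕ
bit true = 1
bit false = 0

count-∷ : ∀ {n} (a b : V n) e E → count a b (e ∷ E) ≡ bit (isEdge a b e) + count a b E
count-∷ a b e E with isEdge a b e
... | true = refl
... | false = refl

count-singleton : ∀ {n} (a b : V n) e → count a b [ e ] ≡ bit (isEdge a b e)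
count-singleton a b e = trans (count-∷ a b e []) (+-identityʳ _)

isEdge-refl : ∀ {n} (a b : V n) → isEdge a b (a , b) ≡ true
isEdge-refl a b rewrite dec-true (a ≟ a) refl | dec-true (b ≟ b) refl = refl

isEdge-sym : ∀ {n} (a b : V n) e → isEdge a b e ≡ isEdge b a e
isEdge-sym a b (u , v) = ∨-comm (does (u ≟ a) ∧ does (v ≟ b)) (does (u ≟ b) ∧ does (v ≟ a))

isEdge-flip : ∀ {n} (a b u v : V n) → isEdge a b (u , v) ≡ isEdge a b (v , u)
isEdge-flip a b u v =
  trans (cong₂ _∨_ (∧-comm (does (u ≟ a)) (does (v ≟ b))) (∧-comm (does (u ≟ b)) (does (v ≟ a))))
        (∨-comm (does (v ≟ b) ∧ does (u ≟ a)) (does (v ≟ a) ∧ does (u ≟ b)))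

count-sym : ∀ {n} (a b : V n) E → count a b E ≡ count b a E
count-sym a b [] = refl
count-sym a b (e ∷ E) = begin
  count a b (e ∷ E)                   ≡⟨ count-∷ a b e E ⟩
  bit (isEdge a b e) + count a b E    ≡⟨ cong₂ _+_ (cong bit (isEdge-sym a b e)) (count-sym a b E) ⟩
  bit (isEdge b a e) + count b a E    ≡⟨ count-∷ b a e E ⟨
  count b a (e ∷ E)                   ∎
  where open ≡-Reasoning

infix 4 _≈ₘ_⊕_

_≈ₘ_⊕_ : ∀ {n} → Graph n → Graph n → Graph n → Set
E ≈ₘ P ⊕ Q = ∀ a b → count a b E ≡ count a b P + count a b Q

∷-⊕ : ∀ {n} (e : Edge n) E → (e ∷ E) ≈ₘ [ e ] ⊕ E
∷-⊕ e E a b = trans (count-∷ a b e E) (cong (_+ count a b E) (sym (count-singleton a b e)))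

++-⊕ : ∀ {n} (P Q : Graph n) → (P ++ Q) ≈ₘ P ⊕ Q
++-⊕ [] Q a b = refl
++-⊕ (e ∷ P) Q a b = begin
  count a b (e ∷ P ++ Q)                           ≡⟨ count-∷ a b e (P ++ Q) ⟩
  bit (isEdge a b e) + count a b (P ++ Q)          ≡⟨ cong (bit (isEdge a b e) +_) (++-⊕ P Q a b) ⟩
  bit (isEdge a b e) + (count a b P + count a b Q) ≡⟨ +-assoc (bit (isEdge a b e)) _ _ ⟨
  bit (isEdge a b e) + count a b P + count a b Q   ≡⟨ cong (_+ count a b Q) (count-∷ a b e P) ⟨
  count a b (e ∷ P) + count a b Q                  ∎
  where open ≡-Reasoning

⊕-assoc : ∀ {n} {E P Q P′ R : Graph n} → E ≈ₘ P ⊕ Q → Q ≈ₘ P′ ⊕ R → E ≈ₘ (P ++ P′) ⊕ R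
⊕-assoc {E = E} {P} {Q} {P′} {R} E≈P⊕Q Q≈P′⊕R a b = begin
  count a b E                                  ≡⟨ E≈P⊕Q a b ⟩
  count a b P + count a b Q                    ≡⟨ cong (count a b P +_) (Q≈P′⊕R a b) ⟩
  count a b P + (count a b P′ + count a b R)   ≡⟨ +-assoc (count a b P) _ _ ⟨
  count a b P + count a b P′ + count a b R     ≡⟨ cong (_+ count a b R) (++-⊕ P P′ a b) ⟨
  count a b (P ++ P′) + count a b R            ∎
  where open ≡-Reasoning

infix 4 _⊆ₘ_

_⊆ₘ_ : ∀ {n} → Graph n → Graph n → Set
P ⊆ₘ E = ∀ a b → count a b P ≤ count a b E

⊕⇒⊆ₘ : ∀ {n} {E P Q : Graph n} → E ≈ₘ P ⊕ Q → P ⊆ₘ E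
⊕⇒⊆ₘ {P = P} {Q} E≈P⊕Q a b = ≤-trans (m≤m+n (count a b P) (count a b Q)) (≤-reflexive (sym (E≈P⊕Q a b)))

-- Degrees

incidence : ∀ {n} → V n → Edge n → ℕ
incidence x (u , v) = bit (does (u ≟ x)) + bit (does (v ≟ x))

incidence-flip : ∀ {n} (x u v : V n) → incidence x (u , v) ≡ incidence x (v , u)
incidence-flip x u v = +-comm (bit (does (u ≟ x))) (bit (does (v ≟ x)))

-- A loop {x,x} is counted once by the sum and once more by the last term.
deg : ∀ {n} → V n → Graph n → ℕ
deg x E = sum (λ y → count x y E) + count x x E

sum-indicator : ∀ {k} (t : Fin k) → sum (λ y → bit (does (t ≟ y))) ≡ 1
sum-indicator {suc k} zero = cong suc (sum-replicate-zero k)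
sum-indicator (suc t) = sum-indicator t

module _ {n} (x : V n) where

  isEdge-loop : ∀ y → isEdge x y (x , x) ≡ does (x ≟ y)
  isEdge-loop y rewrite dec-true (x ≟ x) refl =
    trans (cong (does (x ≟ y) ∨_) (∧-identityʳ (does (x ≟ y)))) (∨-idem (does (x ≟ y)))

  isEdge-out : ∀ v y → v ≢ x → isEdge x y (x , v) ≡ does (v ≟ y)
  isEdge-out v y v≢x rewrite dec-true (x ≟ x) refl | dec-false (v ≟ x) v≢x =
    trans (cong (does (v ≟ y) ∨_) (∧-zeroʳ (does (x ≟ y)))) (∨-identityʳ (does (v ≟ y)))

  isEdge-in : ∀ u y → u ≢ x → isEdge x y (u , x) ≡ does (u ≟ y)
  isEdge-in u y u≢x rewrite dec-false (u ≟ x) u≢x | dec-true (x ≟ x) refl = ∧-identityʳ (does (u ≟ y))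

  isEdge-away : ∀ u v y → u ≢ x → v ≢ x → isEdge x y (u , v) ≡ false
  isEdge-away u v y u≢x v≢x rewrite dec-false (u ≟ x) u≢x | dec-false (v ≟ x) v≢x = ∧-zeroʳ (does (u ≟ y))

  private
    sum-diag : ∀ e (g : V n → Bool) → (∀ y → isEdge x y e ≡ g y) →
               sum (λ y → bit (isEdge x y e)) + bit (isEdge x x e) ≡ sum (λ y → bit (g y)) + bit (g x)
    sum-diag e g eq = cong₂ _+_ (sum-cong-≗ (λ y → cong bit (eq y))) (cong bit (eq x))

  incidence-sum : ∀ e → sum (λ y → bit (isEdge x y e)) + bit (isEdge x x e) ≡ incidence x e
  incidence-sum (u , v) = cases (u ≟ x) (v ≟ x)
    where
    open ≡-Reasoning
    cases : Dec (u ≡ x) → Dec (v ≡ x) → sum (λ y → bit (isEdge x y (u , v))) + bit (isEdge x x (u , v)) ≡ incidence x (u , v)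
    cases (yes refl) (yes refl) = begin
      sum (λ y → bit (isEdge x y (x , x))) + bit (isEdge x x (x , x)) ≡⟨ sum-diag (x , x) (λ y → does (x ≟ y)) isEdge-loop ⟩
      sum (λ y → bit (does (x ≟ y))) + bit (does (x ≟ x))             ≡⟨ cong₂ _+_ (sum-indicator x) (cong bit x≡x) ⟩
      1 + 1                                                           ≡⟨ cong₂ _+_ (cong bit x≡x) (cong bit x≡x) ⟨
      incidence x (x , x)                                             ∎
      where x≡x = dec-true (x ≟ x) refl
    cases (yes refl) (no v≢x) = begin
      sum (λ y → bit (isEdge x y (x , v))) + bit (isEdge x x (x , v)) ≡⟨ sum-diag (x , v) (λ y → does (v ≟ y)) (λ y → isEdge-out v y v≢x) ⟩
      sum (λ y → bit (does (v ≟ y))) + bit (does (v ≟ x))             ≡⟨ cong₂ _+_ (sum-indicator v) (cong bit v≠x) ⟩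
      1 + 0                                                           ≡⟨ cong₂ _+_ (cong bit (dec-true (x ≟ x) refl)) (cong bit v≠x) ⟨
      incidence x (x , v)                                             ∎
      where v≠x = dec-false (v ≟ x) v≢x
    cases (no u≢x) (yes refl) = begin
      sum (λ y → bit (isEdge x y (u , x))) + bit (isEdge x x (u , x)) ≡⟨ sum-diag (u , x) (λ y → does (u ≟ y)) (λ y → isEdge-in u y u≢x) ⟩
      sum (λ y → bit (does (u ≟ y))) + bit (does (u ≟ x))             ≡⟨ cong₂ _+_ (sum-indicator u) (cong bit u≠x) ⟩
      1 + 0                                                           ≡⟨ +-comm 1 0 ⟩
      0 + 1                                                           ≡⟨ cong₂ _+_ (cong bit u≠x) (cong bit (dec-true (x ≟ x) refl)) ⟨
      incidence x (u , x)                                             ∎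
      where u≠x = dec-false (u ≟ x) u≢x
    cases (no u≢x) (no v≢x) = begin
      sum (λ y → bit (isEdge x y (u , v))) + bit (isEdge x x (u , v)) ≡⟨ sum-diag (u , v) (λ _ → false) (λ y → isEdge-away u v y u≢x v≢x) ⟩
      sum (λ (_ : V n) → 0) + 0                                       ≡⟨ cong (_+ 0) (sum-replicate-zero (suc (suc n))) ⟩
      0 + 0                                                           ≡⟨ cong₂ _+_ (cong bit (dec-false (u ≟ x) u≢x)) (cong bit (dec-false (v ≟ x) v≢x)) ⟨
      incidence x (u , v)                                             ∎

  deg-singleton : ∀ e → deg x [ e ] ≡ incidence x e
  deg-singleton e = trans (cong₂ _+_ (sum-cong-≗ (λ y → count-singleton x y e)) (count-singleton x x e)) (incidence-sum e)

  deg-cong : ∀ E F → (∀ y → count x y E ≡ count x y F) → deg x E ≡ deg x F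
  deg-cong E F eq = cong₂ _+_ (sum-cong-≗ eq) (eq x)

  deg-⊕ : ∀ E P Q → E ≈ₘ P ⊕ Q → deg x E ≡ deg x P + deg x Q
  deg-⊕ E P Q E≈P⊕Q = begin
    deg x E                                                                ≡⟨ cong₂ _+_ (sum-cong-≗ (E≈P⊕Q x)) (E≈P⊕Q x x) ⟩
    sum (λ y → count x y P + count x y Q) + (count x x P + count x x Q)    ≡⟨ cong (_+ (count x x P + count x x Q)) (∑-distrib-+ (λ y → count x y P) (λ y → count x y Q)) ⟩
    (sum (λ y → count x y P) + sum (λ y → count x y Q)) + (count x x P + count x x Q) ≡⟨ interchange (sum (λ y → count x y P)) (sum (λ y → count x y Q)) (count x x P) (count x x Q) ⟩
    deg x P + deg x Q                                                      ∎
    where open ≡-Reasoning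

  deg-∷ : ∀ e E → deg x (e ∷ E) ≡ incidence x e + deg x E
  deg-∷ e E = trans (deg-⊕ (e ∷ E) [ e ] E (∷-⊕ e E)) (cong (_+ deg x E) (deg-singleton e))

  count≤deg : ∀ y E → count x y E ≤ deg x E
  count≤deg y E = begin
    count x y E                                                  ≤⟨ m≤m+n (count x y E) _ ⟩
    count x y E + sum (removeAt (λ z → count x z E) y)           ≡⟨ sum-remove (λ z → count x z E) ⟨
    sum (λ z → count x z E)                                      ≤⟨ m≤m+n _ (count x x E) ⟩
    deg x E                                                      ∎
    where open ≤-Reasoning

  deg-[] : deg x [] ≡ 0
  deg-[] = trans (+-identityʳ _) (sum-replicate-zero (suc (suc n)))

  deg-∷∷ : ∀ e f R → deg x (e ∷ f ∷ R) ≡ incidence x e + incidence x f + deg x R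
  deg-∷∷ e f R = trans (deg-∷ e (f ∷ R)) (trans (cong (incidence x e +_) (deg-∷ f R)) (sym (+-assoc (incidence x e) (incidence x f) (deg x R))))

  incidence-self : ∀ v → incidence x (x , v) ≡ suc (bit (does (v ≟ x)))
  incidence-self v rewrite dec-true (x ≟ x) refl = refl

  incidence-other : ∀ u v → u ≢ x → incidence x (u , v) ≡ bit (does (v ≟ x))
  incidence-other u v u≢x rewrite dec-false (u ≟ x) u≢x = refl

  incidence-away : ∀ u v → u ≢ x → v ≢ x → incidence x (u , v) ≡ 0
  incidence-away u v u≢x v≢x rewrite dec-false (u ≟ x) u≢x | dec-false (v ≟ x) v≢x = refl

deg-DCJ : ∀ {n} {E E′ : Graph n} → PrefixDCJ E E′ → ∀ x → deg x E ≡ deg x E′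
deg-DCJ {E = E} {E′} (u , v , w , z , R , _ , E≈ , E′≈) x with E′≈
... | inj₁ E′≈₁ = begin
  deg x E                                                                  ≡⟨ deg-cong x E ((u , v) ∷ (w , z) ∷ R) (E≈ x) ⟩
  deg x ((u , v) ∷ (w , z) ∷ R)                                            ≡⟨ deg-∷∷ x (u , v) (w , z) R ⟩
  incidence x (u , v) + incidence x (w , z) + deg x R                      ≡⟨ cong (_+ deg x R) (interchange (bit (does (u ≟ x))) _ _ _) ⟩
  incidence x (u , w) + incidence x (v , z) + deg x R                      ≡⟨ deg-∷∷ x (u , w) (v , z) R ⟨
  deg x ((u , w) ∷ (v , z) ∷ R)                                            ≡⟨ deg-cong x E′ ((u , w) ∷ (v , z) ∷ R) (E′≈₁ x) ⟨
  deg x E′                                                                 ∎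
  where open ≡-Reasoning
... | inj₂ E′≈₂ = begin
  deg x E                                                                  ≡⟨ deg-cong x E ((u , v) ∷ (w , z) ∷ R) (E≈ x) ⟩
  deg x ((u , v) ∷ (w , z) ∷ R)                                            ≡⟨ deg-∷∷ x (u , v) (w , z) R ⟩
  incidence x (u , v) + incidence x (w , z) + deg x R                      ≡⟨ cong (λ i → incidence x (u , v) + i + deg x R) (+-comm (bit (does (w ≟ x))) _) ⟩
  incidence x (u , v) + incidence x (z , w) + deg x R                      ≡⟨ cong (_+ deg x R) (interchange (bit (does (u ≟ x))) _ _ _) ⟩
  incidence x (u , z) + incidence x (v , w) + deg x R                      ≡⟨ deg-∷∷ x (u , z) (v , w) R ⟨
  deg x ((u , z) ∷ (v , w) ∷ R)                                            ≡⟨ deg-cong x E′ ((u , z) ∷ (v , w) ∷ R) (E′≈₂ x) ⟨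
  deg x E′                                                                 ∎
  where open ≡-Reasoning

deg-DCJs : ∀ {n} {E E′ : Graph n} → PrefixDCJs E E′ → ∀ x → deg x E ≡ deg x E′
deg-DCJs ε                                x = refl
deg-DCJs {E = E} (_◅_ {j = M} s ss) x = trans (deg-DCJ {E = E} {M} s x) (deg-DCJs ss x)

-- Paths and cycles

lastOr : ∀ {A : Set} → A → List A → A
lastOr x []       = x
lastOr _ (y ∷ ys) = lastOr y ys

lastOr-∈ : ∀ {A : Set} (h : A) r → lastOr h r ∈ h ∷ r
lastOr-∈ h []      = here refl
lastOr-∈ h (y ∷ r) = there (lastOr-∈ y r)

last-lastOr : ∀ {A : Set} (h : A) r → last (h ∷ r) ≡ just (lastOr h r)
last-lastOr h []      = refl
last-lastOr h (y ∷ r) = last-lastOr y r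

lastOr-last : ∀ {A : Set} (h : A) r {b} → last (h ∷ r) ≡ just b → lastOr h r ≡ b
lastOr-last h r eq = just-injective (trans (sym (last-lastOr h r)) eq)

pathEdges-snoc : ∀ {n} (h : V n) r y → pathEdges ((h ∷ r) ++ [ y ]) ≡ pathEdges (h ∷ r) ++ [ (lastOr h r , y) ]
pathEdges-snoc h []      y = refl
pathEdges-snoc h (z ∷ r) y = cong ((h , z) ∷_) (pathEdges-snoc z r y)

-- The closing edge of `cycleEdges` starts at a vertex computed by a function local to
-- Defs; reading it off as the source of the last edge identifies it with `lastOr`.
lastSource : ∀ {n} → Graph n → V n
lastSource []           = v0
lastSource (e ∷ [])     = proj₁ e
lastSource (_ ∷ f ∷ es) = lastSource (f ∷ es)

lastSource-snoc : ∀ {n} (P : Graph n) e → lastSource (P ++ [ e ]) ≡ proj₁ e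
lastSource-snoc []          e = refl
lastSource-snoc (_ ∷ [])    e = refl
lastSource-snoc (_ ∷ f ∷ P) e = lastSource-snoc (f ∷ P) e

lastSource-cycleEdges : ∀ {n} (v : V n) r → lastSource (cycleEdges v r) ≡ lastOr v r
lastSource-cycleEdges v []      = refl
lastSource-cycleEdges v (y ∷ r) = begin
  lastSource (cycleEdges v (y ∷ r))  ≡⟨ lastSource-snoc (pathEdges (v ∷ y ∷ r)) _ ⟩
  _                                  ≡⟨ lastSource-snoc (pathEdges (y ∷ r)) _ ⟨
  lastSource (cycleEdges y r)        ≡⟨ lastSource-cycleEdges y r ⟩
  lastOr y r                         ∎
  where open ≡-Reasoning

cycleEdges-≡ : ∀ {n} (v : V n) r → cycleEdges v r ≡ pathEdges (v ∷ r) ++ [ (lastOr v r , v) ]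
cycleEdges-≡ v r = trans (close (pathEdges (v ∷ r)) _ v) (cong (λ c → pathEdges (v ∷ r) ++ [ (c , v) ]) (lastSource-cycleEdges v r))
  where
  close : ∀ P a b → P ++ [ (a , b) ] ≡ P ++ [ (lastSource (P ++ [ (a , b) ]) , b) ]
  close P a b rewrite lastSource-snoc P (a , b) = refl

deg-pathEdges-∉ : ∀ {n} (x : V n) L → x ∉ L → deg x (pathEdges L) ≡ 0
deg-pathEdges-∉ x []          _   = deg-[] x
deg-pathEdges-∉ x (_ ∷ [])    _   = deg-[] x
deg-pathEdges-∉ x (h ∷ y ∷ r) x∉L = begin
  deg x (pathEdges (h ∷ y ∷ r))                    ≡⟨ deg-∷ x (h , y) (pathEdges (y ∷ r)) ⟩
  incidence x (h , y) + deg x (pathEdges (y ∷ r))  ≡⟨ cong₂ _+_ (incidence-away x h y (x∉L ∘ here ∘ sym) (x∉L ∘ there ∘ here ∘ sym))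
                                                                (deg-pathEdges-∉ x (y ∷ r) (x∉L ∘ there)) ⟩
  0                                                ∎
  where open ≡-Reasoning

deg-pathEdges-∈ : ∀ {n} (x : V n) h r → Unique (h ∷ r) → x ∈ h ∷ r →
                  deg x (pathEdges (h ∷ r)) + incidence x (h , lastOr h r) ≡ 2
deg-pathEdges-∈ x _ [] _ (here refl) = cong₂ _+_ (deg-[] x) (trans (incidence-self x x) (cong (suc ∘ bit) (dec-true (x ≟ x) refl)))
deg-pathEdges-∈ x _ (y ∷ r) (x∉r ∷ _) (here refl) = begin
  deg x (pathEdges (x ∷ y ∷ r)) + incidence x (x , l)                     ≡⟨ cong (_+ incidence x (x , l)) (deg-∷ x (x , y) (pathEdges (y ∷ r))) ⟩
  incidence x (x , y) + deg x (pathEdges (y ∷ r)) + incidence x (x , l)   ≡⟨ cong₂ (λ i j → i + j + incidence x (x , l)) (incidence-self x y) (deg-pathEdges-∉ x (y ∷ r) x∉y∷r) ⟩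
  suc (bit (does (y ≟ x))) + 0 + incidence x (x , l)                      ≡⟨ cong₂ (λ i j → suc (bit i) + 0 + j) (dec-false (y ≟ x) (x∉y∷r ∘ here ∘ sym)) (incidence-self x l) ⟩
  1 + 0 + suc (bit (does (l ≟ x)))                                        ≡⟨ cong (λ i → 1 + 0 + suc (bit i)) (dec-false (l ≟ x) (λ l≡x → x∉y∷r (subst (_∈ y ∷ r) l≡x (lastOr-∈ y r)))) ⟩
  2                                                                       ∎
  where
  open ≡-Reasoning
  l = lastOr y r
  x∉y∷r : x ∉ y ∷ r
  x∉y∷r = All¬⇒¬Any x∉r
deg-pathEdges-∈ x h (y ∷ r) (h∉r ∷ unique) (there x∈r) = begin
  deg x (pathEdges (h ∷ y ∷ r)) + incidence x (h , l)                     ≡⟨ cong (_+ incidence x (h , l)) (deg-∷ x (h , y) (pathEdges (y ∷ r))) ⟩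
  incidence x (h , y) + deg x (pathEdges (y ∷ r)) + incidence x (h , l)   ≡⟨ cong₂ (λ i j → i + deg x (pathEdges (y ∷ r)) + j) (incidence-other x h y h≢x) (incidence-other x h l h≢x) ⟩
  bit (does (y ≟ x)) + deg x (pathEdges (y ∷ r)) + bit (does (l ≟ x))     ≡⟨ xy∙z≈y∙xz (bit (does (y ≟ x))) _ _ ⟩
  deg x (pathEdges (y ∷ r)) + incidence x (y , l)                         ≡⟨ deg-pathEdges-∈ x y r unique x∈r ⟩
  2                                                                       ∎
  where
  open ≡-Reasoning
  l = lastOr y r
  h≢x : h ≢ x
  h≢x = All.lookup h∉r x∈r

deg-cycleEdges-∉ : ∀ {n} (x v : V n) r → x ∉ v ∷ r → deg x (cycleEdges v r) ≡ 0
deg-cycleEdges-∉ x v r x∉ = begin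
  deg x (cycleEdges v r)                                     ≡⟨ cong (deg x) (cycleEdges-≡ v r) ⟩
  deg x (pathEdges (v ∷ r) ++ [ (lastOr v r , v) ])          ≡⟨ deg-⊕ x (pathEdges (v ∷ r) ++ [ (lastOr v r , v) ]) (pathEdges (v ∷ r)) [ (lastOr v r , v) ] (++-⊕ (pathEdges (v ∷ r)) [ (lastOr v r , v) ]) ⟩
  deg x (pathEdges (v ∷ r)) + deg x [ (lastOr v r , v) ]     ≡⟨ cong₂ _+_ (deg-pathEdges-∉ x (v ∷ r) x∉) (deg-singleton x (lastOr v r , v)) ⟩
  incidence x (lastOr v r , v)                               ≡⟨ incidence-away x (lastOr v r) v (λ l≡x → x∉ (subst (_∈ v ∷ r) l≡x (lastOr-∈ v r))) (x∉ ∘ here ∘ sym) ⟩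
  0                                                          ∎
  where open ≡-Reasoning

-- Degree 1 at 0 and n+1 and 2 elsewhere, phrased as: adding the edge {0,n+1} gives degree 2 everywhere.
LinearDegrees : ∀ n → Graph n → Set
LinearDegrees n E = ∀ x → deg x E + incidence x (v0 , vEnd n) ≡ 2

linear⇒linearDegrees : ∀ n G → Linear n G → LinearDegrees n G
linear⇒linearDegrees n G ((rest , unique , last≡ , members , counts) , reachable) x = begin
  deg x G + incidence x (v0 , vEnd n)                          ≡⟨ cong₂ _+_ (deg-cong x G P (λ y → counts x y x∈)) (cong (λ b → incidence x (v0 , b)) (sym (lastOr-last v0 rest last≡))) ⟩
  deg x P + incidence x (v0 , lastOr v0 rest)                  ≡⟨ deg-pathEdges-∈ x v0 rest unique x∈ ⟩
  2                                                            ∎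
  where
  open ≡-Reasoning
  P = pathEdges (v0 ∷ rest)
  x∈ : x ∈ v0 ∷ rest
  x∈ = Equivalence.from (members x) (reachable x)

linearDegrees-DCJs : ∀ {n} {G G′ : Graph n} → PrefixDCJs G G′ → LinearDegrees n G → LinearDegrees n G′
linearDegrees-DCJs {n} steps degrees x = trans (cong (_+ incidence x (v0 , vEnd n)) (sym (deg-DCJs steps x))) (degrees x)

reach-sym : ∀ {n} (E : Graph n) {a b} → Reach E a b → Reach E b a
reach-sym E = reverse (λ {a} {b} → subst (1 ≤_) (count-sym a b E))

pathEdges-reach : ∀ {n} {E : Graph n} h r → pathEdges (h ∷ r) ⊆ₘ E → ∀ {x} → x ∈ h ∷ r → Reach E h x
pathEdges-reach h r       _ (here refl) = ε
pathEdges-reach {E = E} h (y ∷ r) P⊆E (there x∈) = h~y ◅ pathEdges-reach {E = E} y r tail⊆E x∈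
  where
  tail = pathEdges (y ∷ r)
  first : ∀ a b → count a b (pathEdges (h ∷ y ∷ r)) ≡ bit (isEdge a b (h , y)) + count a b tail
  first a b = count-∷ a b (h , y) tail
  h~y : Adj E h y
  h~y = begin
    1                                          ≤⟨ s≤s z≤n ⟩
    suc (count h y tail)                       ≡⟨ cong (λ b → bit b + count h y tail) (isEdge-refl h y) ⟨
    bit (isEdge h y (h , y)) + count h y tail  ≡⟨ first h y ⟨
    count h y (pathEdges (h ∷ y ∷ r))          ≤⟨ P⊆E h y ⟩
    count h y E                                ∎
    where open ≤-Reasoning
  tail⊆E : tail ⊆ₘ E
  tail⊆E a b = ≤-trans (≤-trans (m≤n+m _ _) (≤-reflexive (sym (first a b)))) (P⊆E a b)

PathComp⇒Reach : ∀ {n} {E : Graph n} {a b} → PathComp E a b → Reach E a b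
PathComp⇒Reach {a = a} (rest , _ , last≡ , members , _) =
  Equivalence.to (members _) (subst (_∈ a ∷ rest) (lastOr-last a rest last≡) (lastOr-∈ a rest))

component : ∀ {n} {E P R : Graph n} {s} L → E ≈ₘ P ⊕ R → s ∈ L
          → (∀ x → x ∈ L → Reach E s x)
          → (∀ x → x ∉ L → deg x P ≡ 0)
          → (∀ x → x ∈ L → deg x R ≡ 0)
          → (∀ x y → x ∈ L → count x y E ≡ count x y P) × (∀ x → (x ∈ L) ⇔ Reach E s x)
component {E = E} {P} {R} {s} L E≈P⊕R s∈L reach P-on-L R-off-L = counts , λ x → mk⇔ (reach x) (closed s∈L)
  where
  counts : ∀ x y → x ∈ L → count x y E ≡ count x y P
  counts x y x∈L = begin
    count x y E                ≡⟨ E≈P⊕R x y ⟩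
    count x y P + count x y R  ≡⟨ cong (count x y P +_) (n≤0⇒n≡0 (≤-trans (count≤deg x y R) (≤-reflexive (R-off-L x x∈L)))) ⟩
    count x y P + 0            ≡⟨ +-identityʳ _ ⟩
    count x y P                ∎
    where open ≡-Reasoning

  neighbour-in-L : ∀ {a c} → a ∈ L → Adj E a c → c ∈ L
  neighbour-in-L {a} {c} a∈L a~c with any? (c ≟_) L
  ... | yes c∈L = c∈L
  ... | no  c∉L = contradiction 1≤deg[c] (λ ())
    where
    1≤deg[c] : 1 ≤ 0
    1≤deg[c] = begin
      1            ≤⟨ a~c ⟩
      count a c E  ≡⟨ trans (counts a c a∈L) (count-sym a c P) ⟩
      count c a P  ≤⟨ count≤deg c a P ⟩
      deg c P      ≡⟨ P-on-L c c∉L ⟩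
      0            ∎
      where open ≤-Reasoning

  closed : ∀ {a b} → a ∈ L → Reach E a b → b ∈ L
  closed a∈L ε            = a∈L
  closed a∈L (a~c ◅ c⇝b) = closed (neighbour-in-L a∈L a~c) c⇝b

-- Walking along unused edges

next-edge : ∀ {n} (c : V n) Q → 1 ≤ deg c Q →
            Σ (V n) λ y → Σ (Graph n) λ R → Q ≈ₘ [ (c , y) ] ⊕ R × length R < length Q
next-edge c [] 1≤deg = contradiction (subst (1 ≤_) (deg-[] c) 1≤deg) (λ ())
next-edge c ((u , v) ∷ Q) 1≤deg = cases (u ≟ c) (v ≟ c)
  where
  open ≡-Reasoning
  Result = Σ _ λ y → Σ _ λ R → ((u , v) ∷ Q) ≈ₘ [ (c , y) ] ⊕ R × length R < suc (length Q)

  cases : Dec (u ≡ c) → Dec (v ≡ c) → Result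
  cases (yes refl) _          = v , Q , ∷-⊕ (u , v) Q , ≤-refl
  cases (no _)     (yes refl) = u , Q , flipped , ≤-refl
    where
    flipped : ((u , v) ∷ Q) ≈ₘ [ (v , u) ] ⊕ Q
    flipped a b = trans (∷-⊕ (u , v) Q a b)
      (cong (_+ count a b Q) (trans (count-singleton a b (u , v)) (trans (cong bit (isEdge-flip a b u v)) (sym (count-singleton a b (v , u))))))
  cases (no u≢c)   (no v≢c)   with next-edge c Q (subst (1 ≤_) deg-rest 1≤deg)
    where
    deg-rest : deg c ((u , v) ∷ Q) ≡ deg c Q
    deg-rest = trans (deg-∷ c (u , v) Q) (cong (_+ deg c Q) (incidence-away c u v u≢c v≢c))
  ... | y , R , Q≈ , shorter = y , (u , v) ∷ R , moved , s≤s shorter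
    where
    moved : ((u , v) ∷ Q) ≈ₘ [ (c , y) ] ⊕ ((u , v) ∷ R)
    moved a b = begin
      count a b ((u , v) ∷ Q)                                          ≡⟨ count-∷ a b (u , v) Q ⟩
      bit (isEdge a b (u , v)) + count a b Q                           ≡⟨ cong (bit (isEdge a b (u , v)) +_) (Q≈ a b) ⟩
      bit (isEdge a b (u , v)) + (count a b [ (c , y) ] + count a b R) ≡⟨ x∙yz≈y∙xz (bit (isEdge a b (u , v))) (count a b [ (c , y) ]) (count a b R) ⟩
      count a b [ (c , y) ] + (bit (isEdge a b (u , v)) + count a b R) ≡⟨ cong (count a b [ (c , y) ] +_) (count-∷ a b (u , v) R) ⟨
      count a b [ (c , y) ] + count a b ((u , v) ∷ R)                  ∎

record Trail {n} (E : Graph n) (s : V n) : Set where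
  constructor trail
  field
    rest   : List (V n)
    unused : Graph n
    unique : Unique (s ∷ rest)
    split  : E ≈ₘ pathEdges (s ∷ rest) ⊕ unused

  vertices : List (V n)
  vertices = s ∷ rest

  end : V n
  end = lastOr s rest

open Trail

Exhausted : ∀ {n} {E : Graph n} {s} → Trail E s → Set
Exhausted t = ∀ x → x ∈ vertices t → deg x (unused t) ≡ 0

module _ {n} {E : Graph n} {s : V n} where

  start : Trail E s
  start = trail [] E ([] ∷ []) (λ _ _ → refl)

  trail-reach : (t : Trail E s) → ∀ {x} → x ∈ vertices t → Reach E s x
  trail-reach t = pathEdges-reach {E = E} s (rest t) (⊕⇒⊆ₘ {E = E} {pathEdges (vertices t)} {unused t} (split t))

  extend : (t : Trail E s) {y : V n} {R : Graph n} → unused t ≈ₘ [ (end t , y) ] ⊕ R → y ∉ vertices t → Trail E s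
  extend t {y} {R} U≈ y∉ = trail (rest t ++ [ y ]) R unique′ split′
    where
    unique′ : Unique (vertices t ++ [ y ])
    unique′ = Unique.++⁺ (unique t) ([] ∷ []) λ { (y∈ , here refl) → y∉ y∈ }
    split′ : E ≈ₘ pathEdges (vertices t ++ [ y ]) ⊕ R
    split′ = subst (λ P → E ≈ₘ P ⊕ R) (sym (pathEdges-snoc s (rest t) y))
                   (⊕-assoc {E = E} {pathEdges (vertices t)} {unused t} {[ (end t , y) ]} {R} (split t) U≈)

  unused-deg : (t : Trail E s) {x : V n} → x ∈ vertices t → ∀ k → deg x E + k ≡ 2 →
               deg x (unused t) + k ≡ incidence x (s , end t)
  unused-deg t {x} x∈ k deg+k≡2 = +-cancelˡ-≡ (deg x E) _ _ (begin
    deg x E + (deg x U + k)                ≡⟨ x∙yz≈y∙xz (deg x E) (deg x U) k ⟩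
    deg x U + (deg x E + k)                ≡⟨ cong (deg x U +_) (trans deg+k≡2 (sym (deg-pathEdges-∈ x s (rest t) (unique t) x∈))) ⟩
    deg x U + (deg x P + incidence x (s , end t)) ≡⟨ xy∙z≈y∙xz (deg x P) (deg x U) _ ⟨
    deg x P + deg x U + incidence x (s , end t)   ≡⟨ cong (_+ incidence x (s , end t)) (deg-⊕ x E P U (split t)) ⟨
    deg x E + incidence x (s , end t)      ∎)
    where
    open ≡-Reasoning
    U = unused t
    P = pathEdges (vertices t)

  -- An unused edge from the end back into the trail gives its target too many unused edges.
  no-revisit : (t : Trail E s) {y : V n} {R : Graph n} {k : ℕ} → unused t ≈ₘ [ (end t , y) ] ⊕ R →
               deg y (unused t) + k ≡ incidence y (s , end t) → bit (does (s ≟ y)) ≤ k → ⊥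
  no-revisit t {y} {R} {k} U≈ balanced bs≤k = <-irrefl refl (begin-strict
    bs + be                  ≤⟨ +-monoˡ-≤ be bs≤k ⟩
    k + be                   ≡⟨ +-comm k be ⟩
    be + k                   <⟨ s≤s (+-monoˡ-≤ k (m≤m+n be (deg y R))) ⟩
    suc be + deg y R + k     ≡⟨ cong (_+ k) deg-y ⟨
    deg y (unused t) + k     ≡⟨ balanced ⟩
    bs + be                  ∎)
    where
    open ≤-Reasoning
    bs = bit (does (s ≟ y))
    be = bit (does (end t ≟ y))
    deg-y : deg y (unused t) ≡ suc be + deg y R
    deg-y = begin-equality
      deg y (unused t)                     ≡⟨ deg-⊕ y (unused t) [ (end t , y) ] R U≈ ⟩
      deg y [ (end t , y) ] + deg y R      ≡⟨ cong (_+ deg y R) (trans (deg-singleton y (end t , y)) (trans (incidence-flip y (end t) y) (incidence-self y (end t)))) ⟩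
      suc be + deg y R                     ∎

module PathWalk {n} {E : Graph n} (degrees : LinearDegrees n E) where

  balanced : (t : Trail E v0) {x : V n} → x ∈ vertices t →
             deg x (unused t) + incidence x (v0 , vEnd n) ≡ incidence x (v0 , end t)
  balanced t x∈ = unused-deg t x∈ _ (degrees _)

  walk : (t : Trail E v0) → Acc _<_ (length (unused t)) → Σ (Trail E v0) λ t′ → end t′ ≡ vEnd n × Exhausted t′
  walk t (acc more) with end t ≟ vEnd n
  ... | yes arrived = t , arrived , λ x x∈ →
    +-cancelʳ-≡ _ (deg x (unused t)) 0 (trans (balanced t x∈) (cong (λ b → incidence x (v0 , b)) arrived))
  ... | no ¬arrived with next-edge (end t) (unused t) (≤-reflexive (sym (+-cancelʳ-≡ b _ 1 deg+b)))
    where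
    open ≡-Reasoning
    b = bit (does (v0 ≟ end t))
    deg+b : deg (end t) (unused t) + b ≡ 1 + b
    deg+b = begin
      deg (end t) (unused t) + b                               ≡⟨ cong (deg (end t) (unused t) +_) (trans (incidence-flip (end t) v0 (vEnd n)) (incidence-other (end t) (vEnd n) v0 (¬arrived ∘ sym))) ⟨
      deg (end t) (unused t) + incidence (end t) (v0 , vEnd n) ≡⟨ balanced t (lastOr-∈ v0 (rest t)) ⟩
      incidence (end t) (v0 , end t)                           ≡⟨ trans (incidence-flip (end t) v0 (end t)) (incidence-self (end t) v0) ⟩
      1 + b                                                    ∎
  ... | y , R , U≈ , shorter with any? (y ≟_) (vertices t)
  ...   | yes y∈ = ⊥-elim (no-revisit t {y} {R} U≈ (balanced t y∈) (m≤m+n _ _))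
  ...   | no  y∉ = walk (extend t {y} {R} U≈ y∉) (more shorter)

module CycleWalk {n} {E : Graph n} {w : V n} (deg≡2 : ∀ x → Reach E w x → deg x E ≡ 2) where

  balanced : (t : Trail E w) {x : V n} → x ∈ vertices t → deg x (unused t) + 0 ≡ incidence x (w , end t)
  balanced t x∈ = unused-deg t x∈ 0 (trans (+-identityʳ _) (deg≡2 _ (trail-reach t x∈)))

  Closes : Trail E w → Set
  Closes t = Σ (Graph n) λ R → unused t ≈ₘ [ (end t , w) ] ⊕ R × (∀ x → x ∈ vertices t → deg x R ≡ 0)

  walk : (t : Trail E w) → Acc _<_ (length (unused t)) → Σ (Trail E w) Closes
  walk t (acc more) with next-edge (end t) (unused t) (subst (1 ≤_) (sym deg≡) (s≤s z≤n))
    where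
    deg≡ : deg (end t) (unused t) ≡ suc (bit (does (w ≟ end t)))
    deg≡ = trans (sym (+-identityʳ _))
                 (trans (balanced t (lastOr-∈ w (rest t))) (trans (incidence-flip (end t) w (end t)) (incidence-self (end t) w)))
  ... | y , R , U≈ , shorter with y ≟ w
  ...   | yes refl = t , R , U≈ , λ x x∈ → +-cancelˡ-≡ (incidence x (end t , y)) _ _ (begin
          incidence x (end t , y) + deg x R   ≡⟨ trans (deg-⊕ x (unused t) [ (end t , y) ] R U≈) (cong (_+ deg x R) (deg-singleton x (end t , y))) ⟨
          deg x (unused t)                    ≡⟨ +-identityʳ _ ⟨
          deg x (unused t) + 0                ≡⟨ balanced t x∈ ⟩
          incidence x (y , end t)             ≡⟨ incidence-flip x y (end t) ⟩
          incidence x (end t , y)             ≡⟨ +-identityʳ _ ⟨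
          incidence x (end t , y) + 0         ∎)
    where open ≡-Reasoning
  ...   | no y≢w with any? (y ≟_) (vertices t)
  ...     | yes y∈ = ⊥-elim (no-revisit t {y} {R} U≈ (balanced t y∈) (≤-reflexive (cong bit (dec-false (w ≟ y) (y≢w ∘ sym)))))
  ...     | no  y∉ = walk (extend t {y} {R} U≈ y∉) (more shorter)

pathComp : ∀ {n} {E : Graph n} → LinearDegrees n E → PathComp E v0 (vEnd n)
pathComp {n} {E} degrees with PathWalk.walk {E = E} degrees start (<-wellFounded _)
... | t , arrived , exhausted =
  rest t , unique t , trans (last-lastOr v0 (rest t)) (cong just arrived) , proj₂ props , proj₁ props
  where
  props = component {E = E} {pathEdges (vertices t)} {unused t} (vertices t) (split t) (here refl)
                    (λ _ → trail-reach t) (λ x → deg-pathEdges-∉ x (vertices t)) exhausted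

cycleComp : ∀ {n} {E : Graph n} {w} → LinearDegrees n E → ¬ Reach E v0 w → CycleComp E w
cycleComp {n} {E} {w} degrees v0↛w with CycleWalk.walk {E = E} deg≡2 start (<-wellFounded _)
  where
  deg≡2 : ∀ x → Reach E w x → deg x E ≡ 2
  deg≡2 x w⇝x = trans (sym (+-identityʳ _)) (trans (cong (deg x E +_) (sym (incidence-away x v0 (vEnd n) v0≢x vEnd≢x))) (degrees x))
    where
    x⇝w : Reach E x w
    x⇝w = reach-sym E w⇝x
    v0≢x : v0 ≢ x
    v0≢x refl = v0↛w x⇝w
    vEnd≢x : vEnd n ≢ x
    vEnd≢x refl = v0↛w (PathComp⇒Reach {E = E} (pathComp {E = E} degrees) ◅◅ x⇝w)
... | t , R , U≈ , exhausted = rest t , unique t , proj₂ props , proj₁ props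
  where
  E≈ : E ≈ₘ cycleEdges w (rest t) ⊕ R
  E≈ = subst (λ C → E ≈ₘ C ⊕ R) (sym (cycleEdges-≡ w (rest t)))
             (⊕-assoc {E = E} {pathEdges (vertices t)} {unused t} {[ (end t , w) ]} {R} (split t) U≈)
  props = component {E = E} {cycleEdges w (rest t)} {R} (vertices t) E≈ (here refl)
                    (λ _ → trail-reach t) (λ x → deg-cycleEdges-∉ x w (rest t)) exhausted

lemma2 : (n : ℕ) (G G' : Graph n) → Linear n G → PrefixDCJs G G'
    → PathComp G' v0 (vEnd n) × (∀ w → ¬ Reach G' v0 w → CycleComp G' w)
lemma2 n G G' linear steps = pathComp {E = G'} degrees , λ _ → cycleComp {E = G'} degrees
  where
  degrees : LinearDegrees n G'
  degrees = linearDegrees-DCJs steps (linear⇒linearDegrees n G linear)
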